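{- Let $q$ be a prime power (of any characteristic) and $\mathcal{Q}=\mathbb{F}_q^3$ with commuting relation $(x_1,y_1,z_1)$ commutes with $(x_2,y_2,z_2)$ iff $x_1y_2-y_1x_2=z_1-z_2$. Then there exists a non-commuting subset of $\mathcal{Q}$ of size $2q$ which is the union of two (affine) lines and which is not contained in any strictly larger non-commuting subset of $\mathcal{Q}$.
   Context: A subset of $\mathcal{Q}$ is non-commuting if no two distinct elements commute. A line is a set $\{(x_0+at,y_0+bt,z_0+ct)\mid t\in\mathbb{F}_q\}$ with $(a,b,c)\neq 0$. -}

module Defs where

open import Level using (0ℓ)
open import Data.Nat using (ℕ)
open import Data.Fin using (Fin)
import Data.Product
open import Data.Product using (Σ; _×_; _,_)
open import Data.Sum using (_⊎_)
open import Data.List using (List)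
open import Data.List.Relation.Unary.Any using (Any)
open import Data.List.Relation.Unary.AllPairs using (AllPairs)
open import Relation.Nullary using (¬_)
open import Relation.Binary using (Decidable)
open import Relation.Binary.PropositionalEquality using (_≡_)
open import Algebra.Bundles using (CommutativeRing)

-- Such q are exactly the prime powers, and F_q is such a field.
record FiniteField (q : ℕ) : Set₁ where
  field
    cring : CommutativeRing 0ℓ 0ℓ
  open CommutativeRing cring public
  field
    1≉0       : ¬ (1# ≈ 0#)
    inverse   : ∀ x → ¬ (x ≈ 0#) → Σ Carrier (λ y → (x * y) ≈ 1#)
    _≟_       : Decidable _≈_
    enum      : Fin q → Carrier
    enum-surj : ∀ x → Σ (Fin q) (λ i → enum i ≈ x)
    enum-inj  : ∀ i j → enum i ≈ enum j → i ≡ j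

module Geometry {q : ℕ} (F : FiniteField q) where
  open FiniteField F

  Point : Set
  Point = Carrier × Carrier × Carrier

  _≈P_ : Point → Point → Set
  (x₁ , y₁ , z₁) ≈P (x₂ , y₂ , z₂) = (x₁ ≈ x₂) × (y₁ ≈ y₂) × (z₁ ≈ z₂)

  Commutes : Point → Point → Set
  Commutes (x₁ , y₁ , z₁) (x₂ , y₂ , z₂) = ((x₁ * y₂) - (y₁ * x₂)) ≈ (z₁ - z₂)

  -- finite subsets of Q represented by lists; membership up to ≈P
  _∈S_ : Point → List Point → Set
  p ∈S S = Any (λ s → p ≈P s) S

  -- the list has no repeated elements (so its length is the subset's size)
  Distinct : List Point → Set
  Distinct S = AllPairs (λ a b → ¬ (a ≈P b)) S

  NonCommuting : List Point → Set
  NonCommuting S = ∀ p p′ → p ∈S S → p′ ∈S S → ¬ (p ≈P p′) → ¬ Commutes p p′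

  record Line : Set where
    field
      base    : Point
      dir     : Point
      dir≠0   : ¬ (dir ≈P (0# , 0# , 0#))

  OnLine : Line → Point → Set
  OnLine L p = Σ Carrier λ t → p ≈P ((x₀ + (a * t)) , (y₀ + (b * t)) , (z₀ + (c * t)))
    where
      open Line L
      x₀ = Data.Product.proj₁ base
      y₀ = Data.Product.proj₁ (Data.Product.proj₂ base)
      z₀ = Data.Product.proj₂ (Data.Product.proj₂ base)
      a = Data.Product.proj₁ dir
      b = Data.Product.proj₁ (Data.Product.proj₂ dir)
      c = Data.Product.proj₂ (Data.Product.proj₂ dir)

  IsUnionOf : List Point → Line → Line → Set
  IsUnionOf S L₁ L₂ = ∀ p → (p ∈S S → OnLine L₁ p ⊎ OnLine L₂ p)
                          × (OnLine L₁ p ⊎ OnLine L₂ p → p ∈S S)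

  Maximal : List Point → Set
  Maximal S = ∀ (T : List Point) → NonCommuting T
            → (∀ p → p ∈S S → p ∈S T) → ∀ p → p ∈S T → p ∈S S

-- Lemma 7.3: in Q = F_q³ with (x₁,y₁,z₁) ~ (x₂,y₂,z₂) iff x₁y₂ − y₁x₂ = z₁ − z₂,
-- the union S of the two lines
--     L₁ = {(t, 1, 0) | t ∈ F_q}     and     L₂ = {(t + 1, 0, t) | t ∈ F_q}
-- is a maximal non-commuting set of size 2q.
--
-- Commuting is first rewritten without subtraction, as x₁y₂ + z₂ = z₁ + y₁x₂,
-- so that all computations are commutative-semiring identities.  Maximality holds for any S that "blocks" Q, i.e. such that every
-- point of Q commutes with some point of S.  For the concrete L₁, L₂ it remains
-- to check that two commuting points of S coincide, and that every (x, y, z)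
-- commutes with (z + 1, 0, z) ∈ L₂ if y = 0, and with ((x − z)/y, 1, 0) ∈ L₁
-- otherwise.
module Submission where

open import Defs
open import Data.Nat using (ℕ; _*_)
open import Data.Product using (Σ; _×_)
open import Data.List using (List; length)
open import Relation.Binary.PropositionalEquality using (_≡_)

import Data.Nat as ℕ
import Data.Nat.Properties as ℕ
open import Data.Product using (_,_; proj₁; proj₂)
open import Data.Sum using (_⊎_; inj₁; inj₂)
open import Data.Empty using (⊥-elim)
open import Data.List using (tabulate; _++_)
open import Data.List.Properties using (length-++; length-tabulate)
open import Data.List.Relation.Unary.Any as Any using ()
import Data.List.Relation.Unary.Any.Properties as Any
import Data.List.Relation.Unary.All.Properties as All
import Data.List.Relation.Unary.AllPairs.Properties as AllPairs
open import Relation.Nullary using (¬_; yes; no; Dec)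
open import Relation.Nullary.Decidable using (_×-dec_)
import Relation.Binary.PropositionalEquality as ≡

module Configuration {q : ℕ} (F : FiniteField q) where
  open FiniteField F renaming (_*_ to _·_)
  open Geometry F
  open import Algebra.Properties.Group +-group using (∙-cancelˡ; ∙-cancelʳ)
  open import Algebra.Solver.Ring.NaturalCoefficients.Default commutativeSemiring
  open import Relation.Binary.Reasoning.Setoid setoid

  reflP : ∀ {p} → p ≈P p
  reflP = refl , refl , refl

  symP : ∀ {p p′} → p ≈P p′ → p′ ≈P p
  symP (ex , ey , ez) = sym ex , sym ey , sym ez

  transP : ∀ {p p′ p″} → p ≈P p′ → p′ ≈P p″ → p ≈P p″
  transP (ex , ey , ez) (ex′ , ey′ , ez′) = trans ex ex′ , trans ey ey′ , trans ez ez′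

  _≟P_ : ∀ p p′ → Dec (p ≈P p′)
  (x , y , z) ≟P (x′ , y′ , z′) = (x ≟ x′) ×-dec ((y ≟ y′) ×-dec (z ≟ z′))

  Commutes⁺ : Point → Point → Set
  Commutes⁺ (x₁ , y₁ , z₁) (x₂ , y₂ , z₂) = ((x₁ · y₂) + z₂) ≈ (z₁ + (y₁ · x₂))

  telescope : ∀ x y z → ((x - y) + (y + z)) ≈ (x + z)
  telescope x y z = begin
    (x + - y) + (y + z)    ≈⟨ solve 4 (λ x ny y z → (x :+ ny) :+ (y :+ z) := (x :+ z) :+ (ny :+ y)) refl x (- y) y z ⟩
    (x + z) + (- y + y)    ≈⟨ +-cong refl (-‿inverseˡ y) ⟩
    (x + z) + 0#           ≈⟨ +-identityʳ _ ⟩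
    x + z                  ∎

  sub⇒add : ∀ {a b c d} → (a - b) ≈ (c - d) → (a + d) ≈ (c + b)
  sub⇒add {a} {b} {c} {d} h = begin
    a + d                  ≈⟨ telescope a b d ⟨
    (a - b) + (b + d)      ≈⟨ +-cong h (+-comm b d) ⟩
    (c - d) + (d + b)      ≈⟨ telescope c d b ⟩
    c + b                  ∎

  add⇒sub : ∀ {a b c d} → (a + d) ≈ (c + b) → (a - b) ≈ (c - d)
  add⇒sub {a} {b} {c} {d} h = ∙-cancelʳ (b + d) (a - b) (c - d) (begin
    (a - b) + (b + d)      ≈⟨ telescope a b d ⟩
    a + d                  ≈⟨ h ⟩
    c + b                  ≈⟨ telescope c d b ⟨
    (c - d) + (d + b)      ≈⟨ +-cong refl (+-comm d b) ⟩
    (c - d) + (b + d)      ∎)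

  commutes⇒⁺ : ∀ p p′ → Commutes p p′ → Commutes⁺ p p′
  commutes⇒⁺ _ _ = sub⇒add

  ⁺⇒commutes : ∀ p p′ → Commutes⁺ p p′ → Commutes p p′
  ⁺⇒commutes _ _ = add⇒sub

  commutes⁺-resp : ∀ {p p′ r r′} → p ≈P r → p′ ≈P r′ → Commutes⁺ p p′ → Commutes⁺ r r′
  commutes⁺-resp (ex , ey , ez) (ex′ , ey′ , ez′) h =
    trans (sym (+-cong (*-cong ex ey′) ez′)) (trans h (+-cong ez (*-cong ey ex′)))

  ·-cancelˡ : ∀ {a s t} → ¬ (a ≈ 0#) → (a · s) ≈ (a · t) → s ≈ t
  ·-cancelˡ {a} {s} {t} a≉0 as≈at with inverse a a≉0
  ... | a⁻¹ , aa⁻¹≈1 = begin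
    s                  ≈⟨ *-identityˡ s ⟨
    1# · s             ≈⟨ *-cong aa⁻¹≈1 refl ⟨
    (a · a⁻¹) · s      ≈⟨ solve 3 (λ a b s → (a :* b) :* s := b :* (a :* s)) refl a a⁻¹ s ⟩
    a⁻¹ · (a · s)      ≈⟨ *-cong refl as≈at ⟩
    a⁻¹ · (a · t)      ≈⟨ solve 3 (λ a b t → b :* (a :* t) := (a :* b) :* t) refl a a⁻¹ t ⟩
    (a · a⁻¹) · t      ≈⟨ *-cong aa⁻¹≈1 refl ⟩
    1# · t             ≈⟨ *-identityˡ t ⟩
    t                  ∎

  param : Line → Carrier → Point
  param record { base = x₀ , y₀ , z₀ ; dir = a , b , c } t = (x₀ + (a · t)) , (y₀ + (b · t)) , (z₀ + (c · t))

  onLine-param : ∀ L t → OnLine L (param L t)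
  onLine-param L t = t , reflP

  param-cong : ∀ L {s t} → s ≈ t → param L s ≈P param L t
  param-cong L s≈t = +-cong refl (*-cong refl s≈t) , +-cong refl (*-cong refl s≈t) , +-cong refl (*-cong refl s≈t)

  -- Distinct parameters give distinct points: some coordinate of the direction is nonzero.
  param-injective : ∀ L {s t} → param L s ≈P param L t → s ≈ t
  param-injective record { base = x₀ , y₀ , z₀ ; dir = a , b , c ; dir≠0 = dir≠0 } (ex , ey , ez)
    with a ≟ 0# | b ≟ 0# | c ≟ 0#
  ... | no a≉0 | _      | _      = ·-cancelˡ a≉0 (∙-cancelˡ x₀ _ _ ex)
  ... | yes _  | no b≉0 | _      = ·-cancelˡ b≉0 (∙-cancelˡ y₀ _ _ ey)
  ... | yes _  | yes _  | no c≉0 = ·-cancelˡ c≉0 (∙-cancelˡ z₀ _ _ ez)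
  ... | yes a≈0 | yes b≈0 | yes c≈0 = ⊥-elim (dir≠0 (a≈0 , b≈0 , c≈0))

  points : Line → List Point
  points L = tabulate (λ i → param L (enum i))

  length-points : ∀ L → length (points L) ≡ q
  length-points L = length-tabulate (λ i → param L (enum i))

  points⁺ : ∀ L {p} → OnLine L p → p ∈S points L
  points⁺ L (t , p≈) with enum-surj t
  ... | i , eᵢ≈t = Any.tabulate⁺ i (transP p≈ (param-cong L (sym eᵢ≈t)))

  points⁻ : ∀ L {p} → p ∈S points L → OnLine L p
  points⁻ L p∈ with Any.tabulate⁻ p∈
  ... | i , p≈ = enum i , p≈

  points-distinct : ∀ L → Distinct (points L)
  points-distinct L = AllPairs.tabulate⁺ (λ {i} {j} i≢j e → i≢j (enum-inj i j (param-injective L e)))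

  _∪_ : Line → Line → List Point
  L₁ ∪ L₂ = points L₁ ++ points L₂

  ∪-length : ∀ L₁ L₂ → length (L₁ ∪ L₂) ≡ 2 * q
  ∪-length L₁ L₂ rewrite length-++ (points L₁) {points L₂} | length-points L₁ | length-points L₂ =
    ≡.cong (q ℕ.+_) (≡.sym (ℕ.+-identityʳ q))

  ∪-isUnion : ∀ L₁ L₂ → IsUnionOf (L₁ ∪ L₂) L₁ L₂
  ∪-isUnion L₁ L₂ p = split , join
    where
      split : p ∈S (L₁ ∪ L₂) → OnLine L₁ p ⊎ OnLine L₂ p
      split p∈ with Any.++⁻ (points L₁) p∈
      ... | inj₁ p∈₁ = inj₁ (points⁻ L₁ p∈₁)
      ... | inj₂ p∈₂ = inj₂ (points⁻ L₂ p∈₂)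
      join : OnLine L₁ p ⊎ OnLine L₂ p → p ∈S (L₁ ∪ L₂)
      join (inj₁ on₁) = Any.++⁺ˡ (points⁺ L₁ on₁)
      join (inj₂ on₂) = Any.++⁺ʳ (points L₁) (points⁺ L₂ on₂)

  ∪-distinct : ∀ L₁ L₂ → (∀ s t → ¬ (param L₁ s ≈P param L₂ t)) → Distinct (L₁ ∪ L₂)
  ∪-distinct L₁ L₂ disjoint = AllPairs.++⁺ (points-distinct L₁) (points-distinct L₂)
    (All.tabulate⁺ (λ i → All.tabulate⁺ (λ j → disjoint (enum i) (enum j))))

  Blocking : List Point → Set
  Blocking S = ∀ p → Σ Point λ r → r ∈S S × Commutes p r

  -- A blocking set is maximal: a point p of a non-commuting T ⊇ S commutes with
  -- some r ∈ S ⊆ T, so p must be r.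
  blocking⇒maximal : ∀ S → Blocking S → Maximal S
  blocking⇒maximal S blocks T T-nc S⊆T p p∈T with blocks p
  ... | r , r∈S , p~r with p ≟P r
  ...   | yes p≈r = Any.map (transP p≈r) r∈S
  ...   | no p≉r  = ⊥-elim (T-nc p r p∈T (S⊆T r r∈S) p≉r p~r)

  ℓ₁ : Line
  ℓ₁ = record { base = 0# , 1# , 0# ; dir = 1# , 0# , 0# ; dir≠0 = λ dir≈0 → 1≉0 (proj₁ dir≈0) }

  ℓ₂ : Line
  ℓ₂ = record { base = 1# , 0# , 0# ; dir = 1# , 0# , 1# ; dir≠0 = λ dir≈0 → 1≉0 (proj₁ dir≈0) }

  -- Two commuting points of ℓ₁ coincide (x₁ = x₂).
  ℓ₁-commuting : ∀ {s t} → Commutes⁺ (param ℓ₁ s) (param ℓ₁ t) → s ≈ t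
  ℓ₁-commuting {s} {t} h = begin
    s                                         ≈⟨ solve 2 (λ s t → s := (con 0 :+ con 1 :* s) :* (con 1 :+ con 0 :* t) :+ (con 0 :+ con 0 :* t)) refl s t ⟩
    (0# + 1# · s) · (1# + 0# · t) + (0# + 0# · t) ≈⟨ h ⟩
    (0# + 0# · s) + (1# + 0# · s) · (0# + 1# · t) ≈⟨ solve 2 (λ s t → (con 0 :+ con 0 :* s) :+ (con 1 :+ con 0 :* s) :* (con 0 :+ con 1 :* t) := t) refl s t ⟩
    t                                         ∎

  -- Two commuting points of ℓ₂ coincide (z₁ = z₂).
  ℓ₂-commuting : ∀ {s t} → Commutes⁺ (param ℓ₂ s) (param ℓ₂ t) → s ≈ t
  ℓ₂-commuting {s} {t} h = sym (begin
    t                                         ≈⟨ solve 2 (λ s t → t := (con 1 :+ con 1 :* s) :* (con 0 :+ con 0 :* t) :+ (con 0 :+ con 1 :* t)) refl s t ⟩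
    (1# + 1# · s) · (0# + 0# · t) + (0# + 1# · t) ≈⟨ h ⟩
    (0# + 1# · s) + (0# + 0# · s) · (1# + 1# · t) ≈⟨ solve 2 (λ s t → (con 0 :+ con 1 :* s) :+ (con 0 :+ con 0 :* s) :* (con 1 :+ con 1 :* t) := s) refl s t ⟩
    s                                         ∎)

  -- No point of ℓ₁ commutes with a point of ℓ₂: the relation would read t = t + 1.
  ℓ₁ℓ₂-noncommuting : ∀ {s t} → ¬ Commutes⁺ (param ℓ₁ s) (param ℓ₂ t)
  ℓ₁ℓ₂-noncommuting {s} {t} h = 1≉0 (sym (∙-cancelˡ t 0# 1# (begin
    t + 0#                                    ≈⟨ solve 2 (λ s t → t :+ con 0 := (con 0 :+ con 1 :* s) :* (con 0 :+ con 0 :* t) :+ (con 0 :+ con 1 :* t)) refl s t ⟩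
    (0# + 1# · s) · (0# + 0# · t) + (0# + 1# · t) ≈⟨ h ⟩
    (0# + 0# · s) + (1# + 0# · s) · (1# + 1# · t) ≈⟨ solve 2 (λ s t → (con 0 :+ con 0 :* s) :+ (con 1 :+ con 0 :* s) :* (con 1 :+ con 1 :* t) := t :+ con 1) refl s t ⟩
    t + 1#                                    ∎)))

  -- Symmetrically, the relation between ℓ₂(s) and ℓ₁(t) would read s + 1 = s.
  ℓ₂ℓ₁-noncommuting : ∀ {s t} → ¬ Commutes⁺ (param ℓ₂ s) (param ℓ₁ t)
  ℓ₂ℓ₁-noncommuting {s} {t} h = 1≉0 (∙-cancelˡ s 1# 0# (begin
    s + 1#                                    ≈⟨ solve 2 (λ s t → s :+ con 1 := (con 1 :+ con 1 :* s) :* (con 1 :+ con 0 :* t) :+ (con 0 :+ con 0 :* t)) refl s t ⟩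
    (1# + 1# · s) · (1# + 0# · t) + (0# + 0# · t) ≈⟨ h ⟩
    (0# + 1# · s) + (0# + 0# · s) · (0# + 1# · t) ≈⟨ solve 2 (λ s t → (con 0 :+ con 1 :* s) :+ (con 0 :+ con 0 :* s) :* (con 0 :+ con 1 :* t) := s :+ con 0) refl s t ⟩
    s + 0#                                    ∎))

  S : List Point
  S = ℓ₁ ∪ ℓ₂

  ℓ₁-in-S : ∀ t → param ℓ₁ t ∈S S
  ℓ₁-in-S t = proj₂ (∪-isUnion ℓ₁ ℓ₂ _) (inj₁ (onLine-param ℓ₁ t))

  ℓ₂-in-S : ∀ t → param ℓ₂ t ∈S S
  ℓ₂-in-S t = proj₂ (∪-isUnion ℓ₁ ℓ₂ _) (inj₂ (onLine-param ℓ₂ t))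

  -- The lines are disjoint: their points have y = 1 and y = 0 respectively.
  ℓ₁ℓ₂-disjoint : ∀ s t → ¬ (param ℓ₁ s ≈P param ℓ₂ t)
  ℓ₁ℓ₂-disjoint s t (_ , ey , _) = 1≉0 (begin
    1#                 ≈⟨ solve 1 (λ s → con 1 := con 1 :+ con 0 :* s) refl s ⟩
    1# + 0# · s        ≈⟨ ey ⟩
    0# + 0# · t        ≈⟨ solve 1 (λ t → con 0 :+ con 0 :* t := con 0) refl t ⟩
    0#                 ∎)

  commuting-on-lines : ∀ {p p′} → OnLine ℓ₁ p ⊎ OnLine ℓ₂ p → OnLine ℓ₁ p′ ⊎ OnLine ℓ₂ p′ → Commutes⁺ p p′ → p ≈P p′
  commuting-on-lines (inj₁ (s , p≈)) (inj₁ (t , p′≈)) h =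
    transP p≈ (transP (param-cong ℓ₁ (ℓ₁-commuting (commutes⁺-resp p≈ p′≈ h))) (symP p′≈))
  commuting-on-lines (inj₂ (s , p≈)) (inj₂ (t , p′≈)) h =
    transP p≈ (transP (param-cong ℓ₂ (ℓ₂-commuting (commutes⁺-resp p≈ p′≈ h))) (symP p′≈))
  commuting-on-lines (inj₁ (s , p≈)) (inj₂ (t , p′≈)) h = ⊥-elim (ℓ₁ℓ₂-noncommuting (commutes⁺-resp p≈ p′≈ h))
  commuting-on-lines (inj₂ (s , p≈)) (inj₁ (t , p′≈)) h = ⊥-elim (ℓ₂ℓ₁-noncommuting (commutes⁺-resp p≈ p′≈ h))

  S-nonCommuting : NonCommuting S
  S-nonCommuting p p′ p∈ p′∈ p≉p′ p~p′ =
    p≉p′ (commuting-on-lines (proj₁ (∪-isUnion ℓ₁ ℓ₂ p) p∈) (proj₁ (∪-isUnion ℓ₁ ℓ₂ p′) p′∈) (commutes⇒⁺ p p′ p~p′))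

  -- (x, 0, z) commutes with ℓ₂(z) = (z + 1, 0, z), and for y ≠ 0,
  -- (x, y, z) commutes with ℓ₁(s) = (s, 1, 0) where s = (x − z)y⁻¹.
  S-blocking : Blocking S
  S-blocking (x , y , z) with y ≟ 0#
  ... | yes y≈0 = param ℓ₂ z , ℓ₂-in-S z , ⁺⇒commutes _ _ (commutes⁺-resp (refl , sym y≈0 , refl) reflP commutes₂)
    where
      commutes₂ : Commutes⁺ (x , 0# , z) (param ℓ₂ z)
      commutes₂ = solve 2 (λ x z → x :* (con 0 :+ con 0 :* z) :+ (con 0 :+ con 1 :* z) := z :+ con 0 :* (con 1 :+ con 1 :* z)) refl x z
  ... | no y≉0 with inverse y y≉0
  ...   | y⁻¹ , yy⁻¹≈1 = param ℓ₁ s , ℓ₁-in-S s , ⁺⇒commutes _ _ commutes₁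
    where
      s : Carrier
      s = (x - z) · y⁻¹
      commutes₁ : Commutes⁺ (x , y , z) (param ℓ₁ s)
      commutes₁ = begin
        x · (1# + 0# · s) + (0# + 0# · s)   ≈⟨ solve 2 (λ x s → x :* (con 1 :+ con 0 :* s) :+ (con 0 :+ con 0 :* s) := x :+ con 0) refl x s ⟩
        x + 0#                              ≈⟨ +-cong refl (-‿inverseʳ z) ⟨
        x + (z - z)                         ≈⟨ solve 3 (λ x z nz → x :+ (z :+ nz) := z :+ (x :+ nz) :* con 1) refl x z (- z) ⟩
        z + (x - z) · 1#                    ≈⟨ +-cong refl (*-cong refl yy⁻¹≈1) ⟨
        z + (x - z) · (y · y⁻¹)             ≈⟨ solve 5 (λ x z nz y w → z :+ (x :+ nz) :* (y :* w) := z :+ y :* (con 0 :+ con 1 :* ((x :+ nz) :* w))) refl x z (- z) y y⁻¹ ⟩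
        z + y · (0# + 1# · s)               ∎

lemma7p3 : ∀ (q : ℕ) (F : FiniteField q) → let open Geometry F in
    Σ (List Point) λ S → Σ Line λ L₁ → Σ Line λ L₂ →
    Distinct S × length S ≡ 2 * q × NonCommuting S × IsUnionOf S L₁ L₂ × Maximal S
lemma7p3 q F =
  S , ℓ₁ , ℓ₂ ,
  ∪-distinct ℓ₁ ℓ₂ ℓ₁ℓ₂-disjoint ,
  ∪-length ℓ₁ ℓ₂ ,
  S-nonCommuting ,
  ∪-isUnion ℓ₁ ℓ₂ ,
  blocking⇒maximal S S-blocking
  where open Configuration F
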